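{- Let $\mathbb{F}_q$ be a finite field, let $\mathcal{I}\subseteq\{1,\dots,n\}$ be a nonempty subset and let $f_1,\dots,f_n \in \mathbb{F}_q[t]$. Let $P \in \mathbb{F}_q[t_1,\dots,t_n]$ be a polynomial with $\deg_{\mathcal{I}}(P) < \sum_{i\in\mathcal{I}} u(f_i)$. Then \[ \sum_{(x_1,\dots,x_n) \in \mathbb{F}_q^n} P(f_1(x_1),\dots,f_n(x_n)) = 0. \]
   Context: Convention: $0^0=1$. For $f \in \mathbb{F}_q[t]$, $u(f)$ denotes the least positive integer $\delta$ such that $\sum_{x \in \mathbb{F}_q} f(x)^{\delta} \neq 0$ if such $\delta$ exists, and $u(f)=\infty$ otherwise. For a monomial $a t_1^{m_1}\cdots t_n^{m_n}$ with $a\neq 0$, its $\mathcal{I}$-degree is $\sum_{i\in\mathcal{I}} m_i$; $\deg_{\mathcal{I}}(P)$ is the maximum of the $\mathcal{I}$-degrees of the monomial terms of $P$, and $\deg_{\mathcal{I}}(0)=-\infty$. -}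

module Defs where

open import Level using (0ℓ)
open import Algebra.Bundles using (CommutativeRing)
open import Data.Nat using (ℕ; zero; suc; _<_; _⊔_) renaming (_+_ to _+ℕ_)
open import Data.Fin using (Fin; zero; suc) renaming (_≟_ to _Fin≟_)
open import Data.Fin.Subset using (Subset; _∈_; Nonempty)
open import Data.Bool using (Bool; true; false)
open import Data.Vec using (Vec; []; _∷_; lookup)
open import Data.List using (List; []; _∷_; map)
open import Data.List.Relation.Unary.Unique.Propositional using (Unique)
open import Data.Maybe using (Maybe; just; nothing)
open import Data.Product using (Σ; ∃; _×_; _,_; proj₁; proj₂)
open import Data.Unit using (⊤)
open import Data.Empty using (⊥)
open import Relation.Nullary using (¬_; Dec; yes; no)
open import Relation.Binary.PropositionalEquality using (_≡_; refl)

record FiniteField : Set₁ where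
  field
    cring : CommutativeRing 0ℓ 0ℓ
  open CommutativeRing cring public
  field
    1≉0     : ¬ (1# ≈ 0#)
    inverse : ∀ x → ¬ (x ≈ 0#) → ∃ λ y → (x * y) ≈ 1#
    q       : ℕ
    enum    : Fin q → Carrier
    enum-injective  : ∀ i j → enum i ≈ enum j → i ≡ j
    enum-surjective : ∀ x → ∃ λ i → enum i ≈ x

module _ (F : FiniteField) where
  open FiniteField F using (Carrier; _≈_; _+_; _*_; 0#; 1#; q; enum;
    enum-injective; enum-surjective; sym; trans)

  -- x ^ n with the convention 0 ^ 0 = 1
  pow : Carrier → ℕ → Carrier
  pow x zero    = 1#
  pow x (suc n) = x * pow x n

  sumFin : (k : ℕ) → (Fin k → Carrier) → Carrier
  sumFin zero    g = 0#
  sumFin (suc k) g = g zero + sumFin k (λ i → g (suc i))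

  sumF : (Carrier → Carrier) → Carrier
  sumF g = sumFin q (λ i → g (enum i))

  sumFn : (n : ℕ) → (Vec Carrier n → Carrier) → Carrier
  sumFn zero    g = g []
  sumFn (suc n) g = sumF (λ a → sumFn n (λ xs → g (a ∷ xs)))

  -- Univariate polynomials F_q[t]: coefficient lists c₀ ∷ c₁ ∷ … (lowest first)
  Poly₁ : Set
  Poly₁ = List Carrier

  eval₁ : Poly₁ → Carrier → Carrier
  eval₁ []       x = 0#
  eval₁ (c ∷ cs) x = c + x * eval₁ cs x

  -- The value of u(f), with nothing standing for ∞.
  -- IsU f (just δ) : δ is the least positive integer with Σ_x f(x)^δ ≠ 0.
  -- IsU f nothing  : no positive δ has Σ_x f(x)^δ ≠ 0.
  IsU : Poly₁ → Maybe ℕ → Set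
  IsU f (just δ) =
    (0 < δ) × ¬ (sumF (λ x → pow (eval₁ f x) δ) ≈ 0#)
      × (∀ d → 0 < d → d < δ → sumF (λ x → pow (eval₁ f x) d) ≈ 0#)
  IsU f nothing = ∀ d → 0 < d → sumF (λ x → pow (eval₁ f x) d) ≈ 0#

  Term : ℕ → Set
  Term n = Carrier × Vec ℕ n

  record Poly (n : ℕ) : Set where
    field
      terms    : List (Term n)
      distinct : Unique (map proj₂ terms)
  open Poly public

  evalTerm : ∀ {n} → Term n → Vec Carrier n → Carrier
  evalTerm (a , ms) ys = a * monom ms ys
    where
      monom : ∀ {k} → Vec ℕ k → Vec Carrier k → Carrier
      monom []       []       = 1#
      monom (m ∷ ms) (y ∷ ys) = pow y m * monom ms ys

  evalTerms : ∀ {n} → List (Term n) → Vec Carrier n → Carrier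
  evalTerms []       ys = 0#
  evalTerms (t ∷ ts) ys = evalTerm t ys + evalTerms ts ys

  evalP : ∀ {n} → Poly n → Vec Carrier n → Carrier
  evalP P ys = evalTerms (terms P) ys

  degI-mono : ∀ {n} → Subset n → Vec ℕ n → ℕ
  degI-mono []          []       = 0
  degI-mono (true ∷ I)  (m ∷ ms) = m +ℕ degI-mono I ms
  degI-mono (false ∷ I) (m ∷ ms) = degI-mono I ms

  -- max on ℕ ∪ {-∞} (nothing = -∞)
  maxD : Maybe ℕ → Maybe ℕ → Maybe ℕ
  maxD nothing  b        = b
  maxD (just a) nothing  = just a
  maxD (just a) (just b) = just (a ⊔ b)

  _≟0 : ∀ x → Dec (x ≈ 0#)
  x ≟0 with enum-surjective x | enum-surjective 0#
  ... | i , ei≈x | j , ej≈0 with i Fin≟ j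
  ... | yes refl = yes (trans (sym ei≈x) ej≈0)
  ... | no i≢j = no (λ x≈0 → i≢j (enum-injective i j (trans ei≈x (trans x≈0 (sym ej≈0)))))

  module _ where
    -- deg_𝓘: max 𝓘-degree of terms with nonzero coefficient; nothing = -∞
    degI-terms : ∀ {n} → Subset n → List (Term n) → Maybe ℕ
    degI-terms I []              = nothing
    degI-terms I ((a , ms) ∷ ts) with a ≟0
    ... | yes _ = degI-terms I ts
    ... | no  _ = maxD (just (degI-mono I ms)) (degI-terms I ts)

    degI : ∀ {n} → Subset n → Poly n → Maybe ℕ
    degI I P = degI-terms I (terms P)

-- Σ_{i ∈ 𝓘} u_i in ℕ ∪ {∞} (nothing = ∞)
addU : Maybe ℕ → Maybe ℕ → Maybe ℕ
addU (just a) (just b) = just (a +ℕ b)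
addU _        _        = nothing

sumU : ∀ {n} → Subset n → Vec (Maybe ℕ) n → Maybe ℕ
sumU []          []       = just 0
sumU (true ∷ I)  (u ∷ us) = addU u (sumU I us)
sumU (false ∷ I) (u ∷ us) = sumU I us

-- strict order between ℕ ∪ {-∞} (left, nothing = -∞) and ℕ ∪ {∞} (right, nothing = ∞)
_<D_ : Maybe ℕ → Maybe ℕ → Set
nothing <D _        = ⊤
just a  <D nothing  = ⊤
just a  <D just b   = a < b

{-# OPTIONS --safe #-}
module Submission where

-- Summation over 𝔽_qⁿ factors over the coordinates, so the sum of a monomial
-- t₁^m₁ ⋯ tₙ^mₙ evaluated at (f₁(x₁), …, fₙ(xₙ)) is the product of the power
-- sums Σₓ fᵢ(x)^mᵢ.  If the 𝓘-degree of the monomial is below Σ_{i∈𝓘} u(fᵢ),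
-- some mᵢ is below u(fᵢ), and that power sum vanishes: by minimality of u(fᵢ)
-- when mᵢ > 0, and because q·1 = 0 when mᵢ = 0 (compare Σₓ x with Σₓ (x + 1)).

open import Defs
open import Data.Nat using (ℕ; zero; suc; z≤n; s≤s; _<?_)
  renaming (_+_ to _+ℕ_; _<_ to _<ℕ_)
open import Data.Nat.Properties using (<⇒≱; +-mono-≤; ≮⇒≥; ≤-<-trans; m≤m⊔n; m≤n⊔m)
open import Data.Fin using (Fin; zero; suc)
open import Data.Fin.Permutation using (Permutation; permutation)
open import Data.Fin.Subset using (Subset; Nonempty)
open import Data.Vec using (Vec; []; _∷_; lookup; zipWith)
open import Data.List using (List; []; _∷_)
open import Data.Maybe using (Maybe; just; nothing)
open import Data.Bool using (true; false)
open import Data.Product using (∃; _×_; _,_; proj₁; proj₂)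
open import Data.Sum using (_⊎_; inj₁; inj₂)
open import Data.Unit using (tt)
open import Data.Empty using (⊥-elim)
open import Function using (_∘_)
open import Relation.Binary.Core using (_Preserves_⟶_)
open import Relation.Nullary using (yes; no)
import Relation.Binary.PropositionalEquality as ≡

m+n<o+p⇒m<o⊎n<p : ∀ m n o p → m +ℕ n <ℕ o +ℕ p → m <ℕ o ⊎ n <ℕ p
m+n<o+p⇒m<o⊎n<p m n o p m+n<o+p with m <? o | n <? p
... | yes m<o | _       = inj₁ m<o
... | no  _   | yes n<p = inj₂ n<p
... | no  m≮o | no  n≮p = ⊥-elim (<⇒≱ m+n<o+p (+-mono-≤ (≮⇒≥ m≮o) (≮⇒≥ n≮p)))

module _ (F : FiniteField) where
  open FiniteField F hiding (zero)
  open import Algebra.Properties.Semiring.Sum semiring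
    using (sum; sum-cong-≋; ∑-distrib-+; sum-replicate-zero; *-distribˡ-sum; *-distribʳ-sum; sum-permute)
  open import Algebra.Properties.Group +-group using (//-rightDividesˡ; //-rightDividesʳ)
  open import Relation.Binary.Reasoning.Setoid setoid

  sumFin≡sum : ∀ k (g : Fin k → Carrier) → sumFin F k g ≡.≡ sum g
  sumFin≡sum zero    g = ≡.refl
  sumFin≡sum (suc k) g = ≡.cong (g zero +_) (sumFin≡sum k (g ∘ suc))

  sumF≡sum : ∀ g → sumF F g ≡.≡ sum (g ∘ enum)
  sumF≡sum g = sumFin≡sum q (g ∘ enum)

  sumF-cong : ∀ {g h} → (∀ x → g x ≈ h x) → sumF F g ≈ sumF F h
  sumF-cong {g} {h} g≈h = begin
    sumF F g          ≡⟨ sumF≡sum g ⟩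
    sum (g ∘ enum)    ≈⟨ sum-cong-≋ (g≈h ∘ enum) ⟩
    sum (h ∘ enum)    ≡⟨ sumF≡sum h ⟨
    sumF F h          ∎

  sumF-distrib-+ : ∀ g h → sumF F (λ x → g x + h x) ≈ sumF F g + sumF F h
  sumF-distrib-+ g h = begin
    sumF F (λ x → g x + h x)           ≡⟨ sumF≡sum (λ x → g x + h x) ⟩
    sum (λ i → g (enum i) + h (enum i)) ≈⟨ ∑-distrib-+ (g ∘ enum) (h ∘ enum) ⟩
    sum (g ∘ enum) + sum (h ∘ enum)    ≡⟨ ≡.cong₂ _+_ (sumF≡sum g) (sumF≡sum h) ⟨
    sumF F g + sumF F h                ∎

  sumF-zero : sumF F (λ _ → 0#) ≈ 0#
  sumF-zero = ≡.subst (_≈ 0#) (≡.sym (sumF≡sum _)) (sum-replicate-zero q)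

  *-distribʳ-sumF : ∀ c g → sumF F g * c ≈ sumF F (λ x → g x * c)
  *-distribʳ-sumF c g = begin
    sumF F g * c                ≡⟨ ≡.cong (_* c) (sumF≡sum g) ⟩
    sum (g ∘ enum) * c          ≈⟨ *-distribʳ-sum c (g ∘ enum) ⟩
    sum (λ i → g (enum i) * c)  ≡⟨ sumF≡sum (λ x → g x * c) ⟨
    sumF F (λ x → g x * c)      ∎

  *-distribˡ-sumF : ∀ c g → c * sumF F g ≈ sumF F (λ x → c * g x)
  *-distribˡ-sumF c g = begin
    c * sumF F g                ≡⟨ ≡.cong (c *_) (sumF≡sum g) ⟩
    c * sum (g ∘ enum)          ≈⟨ *-distribˡ-sum c (g ∘ enum) ⟩
    sum (λ i → c * g (enum i))  ≡⟨ sumF≡sum (λ x → c * g x) ⟨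
    sumF F (λ x → c * g x)      ∎

  translateIndex : Carrier → Fin q → Fin q
  translateIndex c i = proj₁ (enum-surjective (enum i + c))

  enum-translateIndex : ∀ c i → enum (translateIndex c i) ≈ enum i + c
  enum-translateIndex c i = proj₂ (enum-surjective (enum i + c))

  translateIndex-inverse : ∀ c i → translateIndex (- c) (translateIndex c i) ≡.≡ i
  translateIndex-inverse c i = enum-injective _ _ (begin
    enum (translateIndex (- c) (translateIndex c i)) ≈⟨ enum-translateIndex (- c) _ ⟩
    enum (translateIndex c i) - c                     ≈⟨ +-congʳ (enum-translateIndex c i) ⟩
    (enum i + c) - c                                  ≈⟨ //-rightDividesʳ c (enum i) ⟩
    enum i                                            ∎)

  translateIndex-inverse′ : ∀ c i → translateIndex c (translateIndex (- c) i) ≡.≡ i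
  translateIndex-inverse′ c i = enum-injective _ _ (begin
    enum (translateIndex c (translateIndex (- c) i)) ≈⟨ enum-translateIndex c _ ⟩
    enum (translateIndex (- c) i) + c                 ≈⟨ +-congʳ (enum-translateIndex (- c) i) ⟩
    (enum i - c) + c                                  ≈⟨ //-rightDividesˡ c (enum i) ⟩
    enum i                                            ∎)

  translation : Carrier → Permutation q q
  translation c = permutation (translateIndex c) (translateIndex (- c))
    (translateIndex-inverse′ c) (translateIndex-inverse c)

  sumF-translate : ∀ c {g} → g Preserves _≈_ ⟶ _≈_ → sumF F g ≈ sumF F (λ x → g (x + c))
  sumF-translate c {g} g-cong = begin
    sumF F g                                ≡⟨ sumF≡sum g ⟩
    sum (g ∘ enum)                          ≈⟨ sum-permute (g ∘ enum) (translation c) ⟩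
    sum (g ∘ enum ∘ translateIndex c)       ≈⟨ sum-cong-≋ (g-cong ∘ enum-translateIndex c) ⟩
    sum (λ i → g (enum i + c))              ≡⟨ sumF≡sum (λ x → g (x + c)) ⟨
    sumF F (λ x → g (x + c))                ∎

  sumF-1≈0 : sumF F (λ _ → 1#) ≈ 0#
  sumF-1≈0 = begin
    Σ1                     ≈⟨ +-identityˡ Σ1 ⟨
    0# + Σ1                ≈⟨ +-congʳ (-‿inverseˡ Σx) ⟨
    (- Σx + Σx) + Σ1       ≈⟨ +-assoc (- Σx) Σx Σ1 ⟩
    - Σx + (Σx + Σ1)       ≈⟨ +-congˡ (sumF-distrib-+ (λ x → x) (λ _ → 1#)) ⟨
    - Σx + sumF F (_+ 1#)  ≈⟨ +-congˡ (sumF-translate 1# (λ x≈y → x≈y)) ⟨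
    - Σx + Σx              ≈⟨ -‿inverseˡ Σx ⟩
    0#                     ∎
    where
    Σ1 = sumF F (λ _ → 1#)
    Σx = sumF F (λ x → x)

  sumFn-cong : ∀ n {g h : Vec Carrier n → Carrier} → (∀ xs → g xs ≈ h xs) → sumFn F n g ≈ sumFn F n h
  sumFn-cong zero    g≈h = g≈h []
  sumFn-cong (suc n) g≈h = sumF-cong (λ x → sumFn-cong n (λ xs → g≈h (x ∷ xs)))

  sumFn-distrib-+ : ∀ n (g h : Vec Carrier n → Carrier) →
    sumFn F n (λ xs → g xs + h xs) ≈ sumFn F n g + sumFn F n h
  sumFn-distrib-+ zero    g h = refl
  sumFn-distrib-+ (suc n) g h = trans
    (sumF-cong (λ x → sumFn-distrib-+ n (g ∘ (x ∷_)) (h ∘ (x ∷_))))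
    (sumF-distrib-+ (λ x → sumFn F n (g ∘ (x ∷_))) (λ x → sumFn F n (h ∘ (x ∷_))))

  sumFn-zero : ∀ n → sumFn F n (λ _ → 0#) ≈ 0#
  sumFn-zero zero    = refl
  sumFn-zero (suc n) = trans (sumF-cong (λ _ → sumFn-zero n)) sumF-zero

  *-distribˡ-sumFn : ∀ n c (g : Vec Carrier n → Carrier) → c * sumFn F n g ≈ sumFn F n (λ xs → c * g xs)
  *-distribˡ-sumFn zero    c g = refl
  *-distribˡ-sumFn (suc n) c g = begin
    c * sumF F (λ x → sumFn F n (g ∘ (x ∷_)))        ≈⟨ *-distribˡ-sumF c (λ x → sumFn F n (g ∘ (x ∷_))) ⟩
    sumF F (λ x → c * sumFn F n (g ∘ (x ∷_)))        ≈⟨ sumF-cong (λ x → *-distribˡ-sumFn n c (g ∘ (x ∷_))) ⟩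
    sumF F (λ x → sumFn F n (λ xs → c * g (x ∷ xs))) ∎

  sumFn-product : ∀ n (g : Carrier → Carrier) (h : Vec Carrier n → Carrier) →
    sumFn F (suc n) (λ { (x ∷ xs) → g x * h xs }) ≈ sumF F g * sumFn F n h
  sumFn-product n g h = begin
    sumF F (λ x → sumFn F n (λ xs → g x * h xs)) ≈⟨ sumF-cong (λ x → *-distribˡ-sumFn n (g x) h) ⟨
    sumF F (λ x → g x * sumFn F n h)             ≈⟨ *-distribʳ-sumF (sumFn F n h) g ⟨
    sumF F g * sumFn F n h                       ∎

  powerSum : Poly₁ F → ℕ → Carrier
  powerSum f m = sumF F (λ x → pow F (eval₁ F f x) m)

  IsU⇒powerSum≈0 : ∀ {f u} m → IsU F f u → just m <D u → powerSum f m ≈ 0#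
  IsU⇒powerSum≈0                 zero    _                  _   = sumF-1≈0
  IsU⇒powerSum≈0 {u = nothing} (suc m) vanish             _   = vanish (suc m) (s≤s z≤n)
  IsU⇒powerSum≈0 {u = just δ}  (suc m) (_ , _ , vanish) m<δ = vanish (suc m) (s≤s z≤n) m<δ

  monomial : ∀ {k} → Vec ℕ k → Vec Carrier k → Carrier
  monomial []       []       = 1#
  monomial (m ∷ ms) (y ∷ ys) = pow F y m * monomial ms ys

  evalTerm≈*monomial : ∀ {k} a (ms : Vec ℕ k) ys → evalTerm F (a , ms) ys ≈ a * monomial ms ys
  evalTerm≈*monomial a []       []       = refl
  -- The monomial inside evalTerm is local to its definition; it is reached
  -- through the term with coefficient 1.
  evalTerm≈*monomial a (m ∷ ms) (y ∷ ys) =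
    *-congˡ (*-congˡ (trans (sym (*-identityˡ _)) (trans (evalTerm≈*monomial 1# ms ys) (*-identityˡ _))))

  sumFn-evalTerm : ∀ n a (ms : Vec ℕ n) (ys : Vec Carrier n → Vec Carrier n) →
    sumFn F n (λ xs → evalTerm F (a , ms) (ys xs)) ≈ a * sumFn F n (λ xs → monomial ms (ys xs))
  sumFn-evalTerm n a ms ys = trans
    (sumFn-cong n (λ xs → evalTerm≈*monomial a ms (ys xs)))
    (sym (*-distribˡ-sumFn n a (λ xs → monomial ms (ys xs))))

  powerSum≈0⇒sumFn-monomial≈0 : ∀ {n} (fs : Vec (Poly₁ F) n) (ms : Vec ℕ n) i →
    powerSum (lookup fs i) (lookup ms i) ≈ 0# →
    sumFn F n (λ xs → monomial ms (zipWith (eval₁ F) fs xs)) ≈ 0#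
  powerSum≈0⇒sumFn-monomial≈0 {suc n} (f ∷ fs) (m ∷ ms) i vanish = begin
    sumFn F (suc n) (λ xs → monomial (m ∷ ms) (zipWith (eval₁ F) (f ∷ fs) xs))
      ≈⟨ sumFn-product n (λ x → pow F (eval₁ F f x) m) (λ xs → monomial ms (zipWith (eval₁ F) fs xs)) ⟩
    powerSum f m * sumFn F n (λ xs → monomial ms (zipWith (eval₁ F) fs xs))
      ≈⟨ factor≈0 i vanish ⟩
    0# ∎
    where
    factor≈0 : ∀ i → powerSum (lookup (f ∷ fs) i) (lookup (m ∷ ms) i) ≈ 0# →
      powerSum f m * sumFn F n (λ xs → monomial ms (zipWith (eval₁ F) fs xs)) ≈ 0#
    factor≈0 zero    vanish = trans (*-congʳ vanish) (zeroˡ _)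
    factor≈0 (suc i) vanish = trans (*-congˡ (powerSum≈0⇒sumFn-monomial≈0 fs ms i vanish)) (zeroʳ _)

  degI-mono<sumU-uncons : ∀ {k} b (I : Subset k) m ms u (us : Vec (Maybe ℕ) k) →
    just (degI-mono F (b ∷ I) (m ∷ ms)) <D sumU (b ∷ I) (u ∷ us) →
    just m <D u ⊎ just (degI-mono F I ms) <D sumU I us
  degI-mono<sumU-uncons false I m ms u        us lt = inj₂ lt
  degI-mono<sumU-uncons true  I m ms nothing  us lt = inj₁ tt
  degI-mono<sumU-uncons true  I m ms (just δ) us lt with sumU I us
  ... | nothing = inj₂ tt
  ... | just s  = m+n<o+p⇒m<o⊎n<p m (degI-mono F I ms) δ s lt

  degI-mono<sumU⇒∃mᵢ<uᵢ : ∀ {k} (I : Subset k) ms (us : Vec (Maybe ℕ) k) →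
    just (degI-mono F I ms) <D sumU I us → ∃ λ i → just (lookup ms i) <D lookup us i
  degI-mono<sumU⇒∃mᵢ<uᵢ [] [] [] ()
  degI-mono<sumU⇒∃mᵢ<uᵢ (b ∷ I) (m ∷ ms) (u ∷ us) lt with degI-mono<sumU-uncons b I m ms u us lt
  ... | inj₁ m<u = zero , m<u
  ... | inj₂ lt′ with degI-mono<sumU⇒∃mᵢ<uᵢ I ms us lt′
  ...   | i , mᵢ<uᵢ = suc i , mᵢ<uᵢ

  degI<sumU⇒sumFn-monomial≈0 : ∀ {n} (I : Subset n) fs us → (∀ i → IsU F (lookup fs i) (lookup us i)) →
    (ms : Vec ℕ n) → just (degI-mono F I ms) <D sumU I us →
    sumFn F n (λ xs → monomial ms (zipWith (eval₁ F) fs xs)) ≈ 0#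
  degI<sumU⇒sumFn-monomial≈0 I fs us isU ms lt with degI-mono<sumU⇒∃mᵢ<uᵢ I ms us lt
  ... | i , mᵢ<uᵢ = powerSum≈0⇒sumFn-monomial≈0 fs ms i (IsU⇒powerSum≈0 (lookup ms i) (isU i) mᵢ<uᵢ)

  maxD<D⇒<D×<D : ∀ a r S → maxD F (just a) r <D S → just a <D S × r <D S
  maxD<D⇒<D×<D a nothing  S        lt = lt , tt
  maxD<D⇒<D×<D a (just b) nothing  lt = tt , tt
  maxD<D⇒<D×<D a (just b) (just s) lt = ≤-<-trans (m≤m⊔n a b) lt , ≤-<-trans (m≤n⊔m a b) lt

  sumFn-evalTerms-∷≈0 : ∀ n t ts (ys : Vec Carrier n → Vec Carrier n) →
    sumFn F n (λ xs → evalTerm F t (ys xs)) ≈ 0# → sumFn F n (λ xs → evalTerms F ts (ys xs)) ≈ 0# →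
    sumFn F n (λ xs → evalTerms F (t ∷ ts) (ys xs)) ≈ 0#
  sumFn-evalTerms-∷≈0 n t ts ys head≈0 tail≈0 = begin
    sumFn F n (λ xs → evalTerms F (t ∷ ts) (ys xs))
      ≈⟨ sumFn-distrib-+ n (λ xs → evalTerm F t (ys xs)) (λ xs → evalTerms F ts (ys xs)) ⟩
    sumFn F n (λ xs → evalTerm F t (ys xs)) + sumFn F n (λ xs → evalTerms F ts (ys xs))
      ≈⟨ +-cong head≈0 tail≈0 ⟩
    0# + 0#
      ≈⟨ +-identityˡ 0# ⟩
    0# ∎

  degI<sumU⇒sumFn-evalTerms≈0 : ∀ {n} (I : Subset n) fs us → (∀ i → IsU F (lookup fs i) (lookup us i)) →
    (ts : List (Term F n)) → degI-terms F I ts <D sumU I us →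
    sumFn F n (λ xs → evalTerms F ts (zipWith (eval₁ F) fs xs)) ≈ 0#
  degI<sumU⇒sumFn-evalTerms≈0 {n} I fs us isU [] _ = sumFn-zero n
  degI<sumU⇒sumFn-evalTerms≈0 {n} I fs us isU ((a , ms) ∷ ts) lt with _≟0 F a
  ... | yes a≈0 = sumFn-evalTerms-∷≈0 n (a , ms) ts (zipWith (eval₁ F) fs)
    (trans (sumFn-evalTerm n a ms (zipWith (eval₁ F) fs)) (trans (*-congʳ a≈0) (zeroˡ _)))
    (degI<sumU⇒sumFn-evalTerms≈0 I fs us isU ts lt)
  ... | no _ with maxD<D⇒<D×<D (degI-mono F I ms) (degI-terms F I ts) (sumU I us) lt
  ...   | ltₘ , ltₜ = sumFn-evalTerms-∷≈0 n (a , ms) ts (zipWith (eval₁ F) fs)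
    (trans (sumFn-evalTerm n a ms (zipWith (eval₁ F) fs))
      (trans (*-congˡ (degI<sumU⇒sumFn-monomial≈0 I fs us isU ms ltₘ)) (zeroʳ a)))
    (degI<sumU⇒sumFn-evalTerms≈0 I fs us isU ts ltₜ)

lemma4p1 : (F : FiniteField) → let open FiniteField F in
    (n : ℕ) (I : Subset n) → Nonempty I →
    (fs : Vec (Poly₁ F) n) (us : Vec (Maybe ℕ) n) →
    (∀ i → IsU F (lookup fs i) (lookup us i)) →
    (P : Poly F n) →
    degI F I P <D sumU I us →
    sumFn F n (λ xs → evalP F P (zipWith (eval₁ F) fs xs)) ≈ 0#
lemma4p1 F n I _ fs us isU P = degI<sumU⇒sumFn-evalTerms≈0 F I fs us isU (terms P)
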